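{- Suppose $A,B,A',B'\in\mathcal P$. Then there exist $A^+,B^+\in\mathcal P$ and $\alpha\in{\rm Epi}(A^+,A)$, $\alpha'\in{\rm Epi}(A^+,A')$, $\beta\in{\rm Epi}(B^+,B)$, $\beta'\in{\rm Epi}(B^+,B')$ such that for all $f\in{\rm Epi}(A,B)$ and $f'\in{\rm Epi}(A',B')$ there exists $f^+\in{\rm Epi}(A^+,B^+)$ with $f\circ\alpha=\beta\circ f^+$ and $(f'\circ\alpha')\,R\,(\beta'\circ f^+)$, i.e. $f'(\alpha'(a))\,R\,\beta'(f^+(a))$ for all $a\in A^+$.
   Context: $\mathcal P$ is the class of finite reflexive linear graphs: structures isomorphic to $\{0,\dots,n\}$ ($n\in\mathbb N$) with $xRy\iff|x-y|\le1$. For $A,B\in\mathcal P$, ${\rm Epi}(A,B)$ is the set of epimorphisms, i.e. maps $f:A\to B$ with $aRb\Rightarrow f(a)Rf(b)$ such that every pair $b_1Rb_2$ in $B$ equals $(f(a_1),f(a_2))$ for some $a_1Ra_2$ in $A$. -}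

module Defs where

open import Data.Nat using (ℕ; suc; _≤_; _∸_; _+_)
open import Data.Fin using (Fin; toℕ)
open import Data.Product using (Σ; _×_; ∃; ∃-syntax; _,_)
open import Relation.Binary.PropositionalEquality using (_≡_)

-- The reflexive linear graph with n+1 vertices {0,…,n}; object of 𝒫 indexed by n.
Pt : ℕ → Set
Pt n = Fin (suc n)

_R_ : {n : ℕ} → Pt n → Pt n → Set
x R y = (toℕ x ∸ toℕ y) + (toℕ y ∸ toℕ x) ≤ 1

IsHom : {m n : ℕ} → (Pt m → Pt n) → Set
IsHom {m} f = (a b : Pt m) → a R b → f a R f b

IsEpi : {m n : ℕ} → (Pt m → Pt n) → Set
IsEpi {m} {n} f =
  IsHom f ×
  ((b₁ b₂ : Pt n) → b₁ R b₂ →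
     ∃[ a₁ ] ∃[ a₂ ] (a₁ R a₂ × f a₁ ≡ b₁ × f a₂ ≡ b₂))

Epi : ℕ → ℕ → Set
Epi m n = Σ (Pt m → Pt n) IsEpi

{-# OPTIONS --safe #-}
-- B⁺ is the boustrophedon through the grid B × B′ (rows of B′, alternating direction), with β
-- its column and β′ its row; it passes from row r to row r+1 only at the end column of row r.
-- A⁺ runs through rows q = 0 … 2A′, each sweeping A at half speed, so that every point of A is
-- visited at two consecutive steps; α is the column and α′ q = ⌊q/2⌋. Given f and f′, the
-- point (q, o) of A⁺ goes to the cell (r, f (α (q, o))) of B⁺, where r is f′⌊q/2⌋ before a
-- switch step and f′⌈q/2⌉ after it. The switch is placed while α rests at a preimage under f
-- of the column where the boustrophedon passes between these two rows, so f⁺ is a walk with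
-- β ∘ f⁺ = f ∘ α and β′ ∘ f⁺ within one of f′ ∘ α′. On the even rows r = f′ (q/2), so f⁺
-- reaches both ends of B⁺; and by a discrete intermediate value argument a walk on a path
-- that reaches both ends of the target is an epimorphism.
module Submission where

open import Defs
open import Data.Nat.Base using (ℕ; zero; suc; _+_; _*_; _∸_; _≤_; _<_; z≤n; s≤s; _⊓_; ⌊_/2⌋; ⌈_/2⌉; parity)
open import Data.Nat.Properties
open import Data.Nat.DivMod using (_/_; _%_; m≡m%n+[m/n]*n; m%n<n; [m+kn]%n≡m%n; m≤n⇒m%n≡m; +-distrib-/-∣ʳ; m<n⇒m/n≡0; m*n/n≡m)
open import Data.Nat.Divisibility using (divides-refl)
open import Data.Parity.Base using (Parity; 0ℙ; 1ℙ; _⁻¹)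
open import Data.Parity.Properties using (suc-homo-⁻¹)
open import Data.Fin.Base using (toℕ; fromℕ<)
open import Data.Fin.Properties using (toℕ-fromℕ<; toℕ-injective; toℕ≤pred[n])
open import Data.Product using (Σ; _×_; ∃-syntax; _,_; proj₁; proj₂)
open import Data.Sum using (inj₁; inj₂)
open import Function using (_∘_)
open import Relation.Binary using (Tri; tri<; tri≈; tri>)
open import Relation.Nullary using (¬_; yes; no; contradiction)
open import Relation.Unary using (Decidable)
open import Relation.Binary.PropositionalEquality

infix 4 _~_

data _~_ : ℕ → ℕ → Set where
  stay : ∀ {m} → m ~ m
  up   : ∀ {m} → m ~ suc m
  down : ∀ {m} → suc m ~ m

~-sym : ∀ {m n} → m ~ n → n ~ m
~-sym stay = stay
~-sym up   = down
~-sym down = up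

~-reflexive : ∀ {m n} → m ≡ n → m ~ n
~-reflexive refl = stay

~-suc : ∀ {m n} → m ~ n → suc m ~ suc n
~-suc stay = stay
~-suc up   = up
~-suc down = down

~⇒R : ∀ {N} {x y : Pt N} → toℕ x ~ toℕ y → x R y
~⇒R = bound
  where
  bound : ∀ {m n} → m ~ n → (m ∸ n) + (n ∸ m) ≤ 1
  bound (stay {zero})  = z≤n
  bound (stay {suc m}) = bound (stay {m})
  bound (up {zero})    = s≤s z≤n
  bound (up {suc m})   = bound (up {m})
  bound (down {zero})  = s≤s z≤n
  bound (down {suc m}) = bound (down {m})

R⇒~ : ∀ {N} {x y : Pt N} → x R y → toℕ x ~ toℕ y
R⇒~ = adjacent _ _
  where
  adjacent : ∀ m n → (m ∸ n) + (n ∸ m) ≤ 1 → m ~ n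
  adjacent zero          zero          _        = stay
  adjacent zero          (suc zero)    _        = up
  adjacent zero          (suc (suc n)) (s≤s ())
  adjacent (suc zero)    zero          _        = down
  adjacent (suc (suc m)) zero          (s≤s ())
  adjacent (suc m)       (suc n)       d        = ~-suc (adjacent m n d)

R-refl : ∀ {N} (x : Pt N) → x R x
R-refl x = ~⇒R {x = x} stay

~-cross : ∀ {m n j} → m ~ n → m ≤ j → ¬ n ≤ j → m ≡ j × n ≡ suc j
~-cross stay m≤j m≰j = contradiction m≤j m≰j
~-cross up   m≤j n≰j = let m≡j = ≤-antisym m≤j (≮⇒≥ n≰j) in m≡j , cong suc m≡j
~-cross down m≤j n≰j = contradiction (≤-trans (n≤1+n _) m≤j) n≰j

Walk : (ℕ → ℕ) → Set
Walk g = ∀ p → g p ~ g (suc p)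

walk-~ : ∀ {g m n} → Walk g → m ~ n → g m ~ g n
walk-~ walk stay       = stay
walk-~ walk (up {m})   = walk m
walk-~ walk (down {m}) = ~-sym (walk m)

⊓-walk : ∀ N → Walk (_⊓ N)
⊓-walk zero    zero    = stay
⊓-walk zero    (suc p) = stay
⊓-walk (suc N) zero    = up
⊓-walk (suc N) (suc p) = ~-suc (⊓-walk N p)

∸-walk : ∀ N → Walk (N ∸_)
∸-walk zero    zero    = stay
∸-walk zero    (suc p) = stay
∸-walk (suc N) zero    = down
∸-walk (suc N) (suc p) = ∸-walk N p

⌊/2⌋-walk : Walk ⌊_/2⌋
⌊/2⌋-walk zero          = stay
⌊/2⌋-walk (suc zero)    = up
⌊/2⌋-walk (suc (suc p)) = ~-suc (⌊/2⌋-walk p)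

crossing : ∀ {P : ℕ → Set} → Decidable P → ∀ {u v} → u ≤ v → P u → ¬ P v →
           ∃[ p ] p < v × P p × ¬ P (suc p)
crossing P? {v = zero}  z≤n  Pu ¬Pv = contradiction Pu ¬Pv
crossing P? {v = suc v} u≤v′ Pu ¬Pv′ with P? v
... | yes Pv = v , ≤-refl , Pv , ¬Pv′
... | no ¬Pv with m≤n⇒m<n∨m≡n u≤v′
...   | inj₂ refl = contradiction Pu ¬Pv′
...   | inj₁ u<v′ with crossing P? (≤-pred u<v′) Pu ¬Pv
...     | p , p<v , Pp , ¬Pp′ = p , m<n⇒m<1+n p<v , Pp , ¬Pp′

-- Values above N are clamped to N; every function clamped below already stays in range on
-- the relevant domain, so clamping only serves to make it a map of paths.
clamp : (N : ℕ) → ℕ → Pt N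
clamp N k = fromℕ< (s≤s (m⊓n≤n k N))

toℕ-clamp : ∀ N k → toℕ (clamp N k) ≡ k ⊓ N
toℕ-clamp N k = toℕ-fromℕ< (s≤s (m⊓n≤n k N))

toℕ-clamp-≤ : ∀ {N k} → k ≤ N → toℕ (clamp N k) ≡ k
toℕ-clamp-≤ {N} {k} k≤N = trans (toℕ-clamp N k) (m≤n⇒m⊓n≡m k≤N)

clamp-toℕ : ∀ {N} (x : Pt N) → clamp N (toℕ x) ≡ x
clamp-toℕ x = toℕ-injective (toℕ-clamp-≤ (toℕ≤pred[n] x))

clamp-~ : ∀ N {k l} → k ~ l → clamp N k R clamp N l
clamp-~ N {k} {l} k~l = ~⇒R {x = clamp N k} {y = clamp N l}
  (subst₂ _~_ (sym (toℕ-clamp N k)) (sym (toℕ-clamp N l)) (walk-~ (⊓-walk N) k~l))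

clampMap : ∀ {M} N → (ℕ → ℕ) → Pt M → Pt N
clampMap N g a = clamp N (g (toℕ a))

clampMap-hom : ∀ {M N g} → Walk g → IsHom {M} {N} (clampMap N g)
clampMap-hom {N = N} walk a b aRb = clamp-~ N (walk-~ walk (R⇒~ {x = a} {y = b} aRb))

hom⇒walk : ∀ {M N} {f : Pt M → Pt N} → IsHom f → Walk (λ k → toℕ (f (clamp M k)))
hom⇒walk {M} {f = f} hom p =
  R⇒~ {x = f (clamp M p)} {y = f (clamp M (suc p))} (hom _ _ (clamp-~ M up))

epi⇒surjective : ∀ {M N} {f : Pt M → Pt N} → IsEpi f → ∀ b → ∃[ a ] f a ≡ b
epi⇒surjective (_ , onEdges) b with onEdges b b (R-refl b)
... | a , _ , _ , fa≡b , _ = a , fa≡b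

epi-hits : ∀ {M N} {f : Pt M → Pt N} → IsEpi f → ∀ {y} → y ≤ N → ∃[ a ] toℕ (f a) ≡ y
epi-hits {N = N} epi {y} y≤N =
  let a , fa≡y = epi⇒surjective epi (clamp N y) in a , trans (cong toℕ fa≡y) (toℕ-clamp-≤ y≤N)

module _ {g : ℕ → ℕ} (walk : Walk g) {M N p₀ p₁ : ℕ}
         (p₀≤M : p₀ ≤ M) (p₁≤M : p₁ ≤ M) (gp₀≡0 : g p₀ ≡ 0) (gp₁≡N : g p₁ ≡ N) where

  private
    Realised : ℕ → ℕ → Set
    Realised u v = ∃[ q₁ ] ∃[ q₂ ] q₁ ~ q₂ × q₁ ≤ M × q₂ ≤ M × g q₁ ≡ u × g q₂ ≡ v

    realised-sym : ∀ {u v} → Realised u v → Realised v u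
    realised-sym (q₁ , q₂ , q₁~q₂ , q₁≤M , q₂≤M , e₁ , e₂) =
      q₂ , q₁ , ~-sym q₁~q₂ , q₂≤M , q₁≤M , e₂ , e₁

    realised-stay : ∀ {u v} → Realised u v → Realised u u
    realised-stay (q₁ , _ , _ , q₁≤M , _ , e₁ , _) = q₁ , q₁ , stay , q₁≤M , q₁≤M , e₁ , e₁

    realised-up : ∀ j → j < N → Realised j (suc j)
    realised-up j j<N with ≤-total p₀ p₁
    ... | inj₁ p₀≤p₁ with crossing (λ p → g p ≤? j) p₀≤p₁ (subst (_≤ j) (sym gp₀≡0) z≤n)
                                   (<⇒≱ (subst (j <_) (sym gp₁≡N) j<N))
    ...   | p , p<p₁ , gp≤j , gp′≰j with ~-cross (walk p) gp≤j gp′≰j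
    ...     | e , e′ = p , suc p , up , ≤-trans (<⇒≤ p<p₁) p₁≤M , ≤-trans p<p₁ p₁≤M , e , e′
    realised-up j j<N | inj₂ p₁≤p₀ with crossing (λ p → j <? g p) p₁≤p₀
                                   (subst (j <_) (sym gp₁≡N) j<N)
                                   (λ j<gp₀ → n≮0 (subst (j <_) gp₀≡0 j<gp₀))
    ...   | p , p<p₀ , j<gp , gp′≮j with ~-cross (~-sym (walk p)) (≮⇒≥ gp′≮j) (<⇒≱ j<gp)
    ...     | e′ , e = suc p , p , down , ≤-trans p<p₀ p₀≤M , ≤-trans (<⇒≤ p<p₀) p₀≤M , e′ , e

    realised : ∀ {u v} → u ~ v → u ≤ N → v ≤ N → Realised u v
    realised {u} stay u≤N _ with m≤n⇒m<n∨m≡n u≤N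
    ... | inj₁ u<N = realised-stay (realised-up u u<N)
    ... | inj₂ refl = p₁ , p₁ , stay , p₁≤M , p₁≤M , gp₁≡N , gp₁≡N
    realised {u} up   _ v≤N = realised-up u v≤N
    realised {_} {v} down u≤N _ = realised-sym (realised-up v u≤N)

  walk-epi : IsEpi {M} {N} (clampMap N g)
  walk-epi = clampMap-hom walk , onEdges
    where
    onEdges : ∀ b₁ b₂ → b₁ R b₂ →
              ∃[ a₁ ] ∃[ a₂ ] (a₁ R a₂ × clampMap N g a₁ ≡ b₁ × clampMap N g a₂ ≡ b₂)
    onEdges b₁ b₂ b₁Rb₂
      with realised (R⇒~ {x = b₁} {y = b₂} b₁Rb₂) (toℕ≤pred[n] b₁) (toℕ≤pred[n] b₂)
    ... | q₁ , q₂ , q₁~q₂ , q₁≤M , q₂≤M , e₁ , e₂ =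
      clamp M q₁ , clamp M q₂ ,
      ~⇒R {x = clamp M q₁} {y = clamp M q₂} (subst₂ _~_ (sym t₁) (sym t₂) q₁~q₂) ,
      hits t₁ e₁ , hits t₂ e₂
      where
      t₁ = toℕ-clamp-≤ q₁≤M
      t₂ = toℕ-clamp-≤ q₂≤M
      hits : ∀ {a q b} → toℕ a ≡ q → g q ≡ toℕ b → clampMap N g a ≡ b
      hits {b = b} refl e = trans (cong (clamp N) e) (clamp-toℕ b)

sweep : ℕ → Parity → ℕ → ℕ
sweep N 0ℙ x = x
sweep N 1ℙ x = N ∸ x

sweep-walk : ∀ N π → Walk (sweep N π)
sweep-walk N 0ℙ x = up
sweep-walk N 1ℙ x = ∸-walk N x

sweep-≤ : ∀ {N x} π → x ≤ N → sweep N π x ≤ N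
sweep-≤ 0ℙ x≤N = x≤N
sweep-≤ {N} {x} 1ℙ _ = m∸n≤m N x

sweep-involutive : ∀ {N x} π → x ≤ N → sweep N π (sweep N π x) ≡ x
sweep-involutive 0ℙ _   = refl
sweep-involutive 1ℙ x≤N = m∸[m∸n]≡n x≤N

sweep-next-row : ∀ N q → sweep N (parity q) N ≡ sweep N (parity (suc q)) 0
sweep-next-row N q = turn (parity q) (sym (suc-homo-⁻¹ (suc q)))
  where
  turn : ∀ π {π′} → π′ ≡ π ⁻¹ → sweep N π N ≡ sweep N π′ 0
  turn 0ℙ refl = refl
  turn 1ℙ refl = n∸n≡0 N

-- The point p of a path is cell (row p) (pos p) of a grid with N + 1 steps per row; at step
-- o of row q the boustrophedon is in column sweep N (parity q) o.
module Grid (N : ℕ) where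

  cell : ℕ → ℕ → ℕ
  cell q o = o + q * suc N

  row pos : ℕ → ℕ
  row p = p / suc N
  pos p = p % suc N

  row-cell : ∀ q {o} → o ≤ N → row (cell q o) ≡ q
  row-cell q {o} o≤N = begin
    (o + q * suc N) / suc N           ≡⟨ +-distrib-/-∣ʳ o (divides-refl q) ⟩
    o / suc N + q * suc N / suc N     ≡⟨ cong₂ _+_ (m<n⇒m/n≡0 (s≤s o≤N)) (m*n/n≡m q (suc N)) ⟩
    q                                 ∎
    where open ≡-Reasoning

  pos-cell : ∀ q {o} → o ≤ N → pos (cell q o) ≡ o
  pos-cell q {o} o≤N = trans ([m+kn]%n≡m%n o q (suc N)) (m≤n⇒m%n≡m o≤N)

  cell-row-pos : ∀ p → cell (row p) (pos p) ≡ p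
  cell-row-pos p = sym (m≡m%n+[m/n]*n p (suc N))

  pos≤N : ∀ p → pos p ≤ N
  pos≤N p = ≤-pred (m%n<n p (suc N))

  cell-mono : ∀ {q Q o} → q ≤ Q → o ≤ N → cell q o ≤ cell Q N
  cell-mono q≤Q o≤N = +-mono-≤ o≤N (*-monoˡ-≤ (suc N) q≤Q)

  onGrid : (ℕ → ℕ → ℕ) → ℕ → ℕ
  onGrid g p = g (row p) (pos p)

  onGrid-cell : ∀ g q {o} → o ≤ N → onGrid g (cell q o) ≡ g q o
  onGrid-cell g q o≤N = cong₂ g (row-cell q o≤N) (pos-cell q o≤N)

  -- suc (cell q o) is cell q (suc o), and suc (cell q N) is cell (suc q) 0, definitionally.
  onGrid-walk : ∀ g → (∀ q o → o < N → g q o ~ g q (suc o)) → (∀ q → g q N ~ g (suc q) 0) →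
                Walk (onGrid g)
  onGrid-walk g inRow nextRow p =
    subst (λ p → onGrid g p ~ onGrid g (suc p)) (cell-row-pos p) (step (row p) (pos p) (pos≤N p))
    where
    step : ∀ q o → o ≤ N → onGrid g (cell q o) ~ onGrid g (suc (cell q o))
    step q o o≤N with m≤n⇒m<n∨m≡n o≤N
    ... | inj₁ o<N  =
      subst₂ _~_ (sym (onGrid-cell g q o≤N)) (sym (onGrid-cell g q o<N)) (inRow q o o<N)
    ... | inj₂ refl =
      subst₂ _~_ (sym (onGrid-cell g q ≤-refl)) (sym (onGrid-cell g (suc q) z≤n)) (nextRow q)

  column : ℕ → ℕ
  column = onGrid (λ q → sweep N (parity q))

  column-cell : ∀ q {o} → o ≤ N → column (cell q o) ≡ sweep N (parity q) o
  column-cell = onGrid-cell (λ q → sweep N (parity q))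

  column-walk : Walk column
  column-walk = onGrid-walk _ (λ q o _ → sweep-walk N (parity q) o) (~-reflexive ∘ sweep-next-row N)

  row-walk : Walk row
  row-walk = onGrid-walk (λ q _ → q) (λ _ _ _ → stay) (λ _ → up)

  snake : ℕ → ℕ → ℕ
  snake q x = cell q (sweep N (parity q) x)

  snake-walk : ∀ q → Walk (snake q)
  snake-walk q x = walk-~ {g = λ o → cell q o} (λ _ → up) (sweep-walk N (parity q) x)

  snake-≤ : ∀ {q Q x} → q ≤ Q → x ≤ N → snake q x ≤ cell Q N
  snake-≤ {q} q≤Q x≤N = cell-mono q≤Q (sweep-≤ (parity q) x≤N)

  row-snake : ∀ q {x} → x ≤ N → row (snake q x) ≡ q
  row-snake q x≤N = row-cell q (sweep-≤ (parity q) x≤N)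

  column-snake : ∀ q {x} → x ≤ N → column (snake q x) ≡ x
  column-snake q {x} x≤N = begin
    column (snake q x)                         ≡⟨ column-cell q (sweep-≤ (parity q) x≤N) ⟩
    sweep N (parity q) (sweep N (parity q) x)  ≡⟨ sweep-involutive (parity q) x≤N ⟩
    x                                          ∎
    where open ≡-Reasoning

  exitColumn : ℕ → ℕ
  exitColumn q = sweep N (parity q) N

  snake-exit : ∀ q → snake q (exitColumn q) ≡ cell q N
  snake-exit q = cong (cell q) (sweep-involutive (parity q) ≤-refl)

  snake-enter : ∀ q → snake (suc q) (exitColumn q) ≡ cell (suc q) 0
  snake-enter q = cong (cell (suc q)) (begin
    sweep N π′ (sweep N (parity q) N)  ≡⟨ cong (sweep N π′) (sweep-next-row N q) ⟩
    sweep N π′ (sweep N π′ 0)          ≡⟨ sweep-involutive π′ z≤n ⟩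
    0                                  ∎)
    where
    π′ = parity (suc q)
    open ≡-Reasoning

  snake-leave : ∀ q → snake q (exitColumn q) ~ snake (suc q) (exitColumn q)
  snake-leave q = subst₂ _~_ (sym (snake-exit q)) (sym (snake-enter q)) up

  snake-change-row : ∀ {r r′} → r ~ r′ →
                     snake r (exitColumn (r ⊓ r′)) ~ snake r′ (exitColumn (r ⊓ r′))
  snake-change-row stay = stay
  snake-change-row {r} up rewrite m≤n⇒m⊓n≡m (n≤1+n r) = snake-leave r
  snake-change-row {_} {r′} down rewrite m≥n⇒m⊓n≡n (n≤1+n r′) = ~-sym (snake-leave r′)

threshold : ℕ → ℕ → ℕ → ℕ → ℕ
threshold T a b o with o ≤? T
... | yes _ = a
... | no _  = b

threshold-≤ : ∀ {T o} a b → o ≤ T → threshold T a b o ≡ a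
threshold-≤ {T} {o} a b o≤T with o ≤? T
... | yes _   = refl
... | no o≰T = contradiction o≤T o≰T

threshold-> : ∀ {T o} a b → T < o → threshold T a b o ≡ b
threshold-> {T} {o} a b T<o with o ≤? T
... | yes o≤T = contradiction o≤T (<⇒≱ T<o)
... | no _    = refl

threshold-elim : ∀ (P : ℕ → Set) {T a b} → P a → P b → ∀ o → P (threshold T a b o)
threshold-elim P {T} Pa Pb o with o ≤? T
... | yes _ = Pa
... | no _  = Pb

module Construction (A B A′ B′ : ℕ) where

  n : ℕ
  n = suc (A + A)

  module 𝔸 = Grid n
  module 𝔹 = Grid B

  A⁺ B⁺ : ℕ
  A⁺ = 𝔸.cell (A′ + A′) n
  B⁺ = 𝔹.cell B′ B

  αAt : ℕ → ℕ → ℕ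
  αAt q o = sweep A (parity q) ⌊ o /2⌋

  αAt-in-row : ∀ q o → αAt q o ~ αAt q (suc o)
  αAt-in-row q o = walk-~ (sweep-walk A (parity q)) (⌊/2⌋-walk o)

  ⌊n/2⌋≡A : ⌊ n /2⌋ ≡ A
  ⌊n/2⌋≡A = sym (n≡⌈n+n/2⌉ A)

  αAt-next-row : ∀ q → αAt q n ≡ αAt (suc q) 0
  αAt-next-row q = trans (cong (sweep A (parity q)) ⌊n/2⌋≡A) (sweep-next-row A q)

  visit : ℕ → ℕ → ℕ
  visit q t = sweep A (parity q) t + sweep A (parity q) t

  visit<n : ∀ q {t} → t ≤ A → visit q t < n
  visit<n q t≤A = s≤s (+-mono-≤ s≤A s≤A)
    where s≤A = sweep-≤ (parity q) t≤A

  αAt-visit : ∀ q {t} → t ≤ A → αAt q (visit q t) ≡ t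
  αAt-visit q t≤A =
    trans (cong (sweep A (parity q)) (sym (n≡⌊n+n/2⌋ _))) (sweep-involutive (parity q) t≤A)

  αAt-visit-suc : ∀ q {t} → t ≤ A → αAt q (suc (visit q t)) ≡ t
  αAt-visit-suc q t≤A =
    trans (cong (sweep A (parity q)) (sym (n≡⌈n+n/2⌉ _))) (sweep-involutive (parity q) t≤A)

  α : Epi A⁺ A
  α = clampMap A (𝔸.onGrid αAt) ,
      walk-epi (𝔸.onGrid-walk αAt (λ q o _ → αAt-in-row q o) (~-reflexive ∘ αAt-next-row)) {A⁺} {A}
               z≤n (𝔸.cell-mono {Q = A′ + A′} z≤n ≤-refl)
               refl (trans (𝔸.onGrid-cell αAt 0 ≤-refl) ⌊n/2⌋≡A)

  α′At : ℕ → ℕ → ℕ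
  α′At q _ = ⌊ q /2⌋

  α′ : Epi A⁺ A′
  α′ = clampMap A′ (𝔸.onGrid α′At) ,
       walk-epi (𝔸.onGrid-walk α′At (λ _ _ _ → stay) ⌊/2⌋-walk) {A⁺} {A′}
                z≤n ≤-refl
                refl (trans (𝔸.onGrid-cell α′At (A′ + A′) ≤-refl) (sym (n≡⌊n+n/2⌋ A′)))

  β : Epi B⁺ B
  β = clampMap B 𝔹.column ,
      walk-epi 𝔹.column-walk {B⁺} {B} z≤n (𝔹.cell-mono {Q = B′} z≤n ≤-refl)
               refl (𝔹.column-cell 0 ≤-refl)

  β′ : Epi B⁺ B′
  β′ = clampMap B′ 𝔹.row , walk-epi 𝔹.row-walk {B⁺} {B′} z≤n ≤-refl refl (𝔹.row-cell B′ ≤-refl)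

  module Lift (f : Epi A B) (f′ : Epi A′ B′) where

    F F′ : ℕ → ℕ
    F  x = toℕ (proj₁ f  (clamp A  x))
    F′ x = toℕ (proj₁ f′ (clamp A′ x))

    F-walk : Walk F
    F-walk = hom⇒walk {f = proj₁ f} (proj₁ (proj₂ f))

    F-≤ : ∀ x → F x ≤ B
    F-≤ x = toℕ≤pred[n] (proj₁ f (clamp A x))

    F′-≤ : ∀ x → F′ x ≤ B′
    F′-≤ x = toℕ≤pred[n] (proj₁ f′ (clamp A′ x))

    lower upper : ℕ → ℕ
    lower q = F′ ⌊ q /2⌋
    upper q = F′ ⌈ q /2⌉

    lower~upper : ∀ q → lower q ~ upper q
    lower~upper q = walk-~ (hom⇒walk {f = proj₁ f′} (proj₁ (proj₂ f′))) (⌊/2⌋-walk q)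

    switchColumn : ℕ → ℕ
    switchColumn q = 𝔹.exitColumn (lower q ⊓ upper q)

    pivotHit : ∀ q → ∃[ t ] toℕ (proj₁ f t) ≡ switchColumn q
    pivotHit q = epi-hits (proj₂ f) (sweep-≤ (parity (lower q ⊓ upper q)) ≤-refl)

    pivot : ℕ → Pt A
    pivot q = proj₁ (pivotHit q)

    F-pivot : ∀ q → F (toℕ (pivot q)) ≡ switchColumn q
    F-pivot q = trans (cong (toℕ ∘ proj₁ f) (clamp-toℕ (pivot q))) (proj₂ (pivotHit q))

    switch : ℕ → ℕ
    switch q = visit q (toℕ (pivot q))

    switch<n : ∀ q → switch q < n
    switch<n q = visit<n q (toℕ≤pred[n] (pivot q))

    level : ℕ → ℕ → ℕ
    level q = threshold (switch q) (lower q) (upper q)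

    level-before : ∀ q {o} → o ≤ switch q → level q o ≡ lower q
    level-before q = threshold-≤ (lower q) (upper q)

    level-after : ∀ q {o} → switch q < o → level q o ≡ upper q
    level-after q = threshold-> (lower q) (upper q)

    lower~level : ∀ q o → lower q ~ level q o
    lower~level q = threshold-elim (lower q ~_) stay (lower~upper q)

    level-≤ : ∀ q o → level q o ≤ B′
    level-≤ q = threshold-elim (_≤ B′) (F′-≤ ⌊ q /2⌋) (F′-≤ ⌈ q /2⌉)

    f⁺At : ℕ → ℕ → ℕ
    f⁺At q o = 𝔹.snake (level q o) (F (αAt q o))

    f⁺At-same-level : ∀ q o → level q o ≡ level q (suc o) → f⁺At q o ~ f⁺At q (suc o)
    f⁺At-same-level q o e = subst (λ r → f⁺At q o ~ 𝔹.snake r (F (αAt q (suc o)))) e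
      (walk-~ {g = 𝔹.snake (level q o)} (𝔹.snake-walk (level q o)) (walk-~ F-walk (αAt-in-row q o)))

    f⁺At-switch : ∀ q → f⁺At q (switch q) ~ f⁺At q (suc (switch q))
    f⁺At-switch q = subst₂ _~_ (sym before) (sym after) (𝔹.snake-change-row (lower~upper q))
      where
      pivot≤A = toℕ≤pred[n] (pivot q)
      before : f⁺At q (switch q) ≡ 𝔹.snake (lower q) (switchColumn q)
      before = cong₂ 𝔹.snake (level-before q ≤-refl)
                             (trans (cong F (αAt-visit q pivot≤A)) (F-pivot q))
      after : f⁺At q (suc (switch q)) ≡ 𝔹.snake (upper q) (switchColumn q)
      after = cong₂ 𝔹.snake (level-after q ≤-refl)
                            (trans (cong F (αAt-visit-suc q pivot≤A)) (F-pivot q))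

    f⁺At-in-row : ∀ q o → f⁺At q o ~ f⁺At q (suc o)
    f⁺At-in-row q o = byPosition (<-cmp o (switch q))
      where
      byPosition : Tri (o < switch q) (o ≡ switch q) (switch q < o) → f⁺At q o ~ f⁺At q (suc o)
      byPosition (tri< o<s _ _) =
        f⁺At-same-level q o (trans (level-before q (<⇒≤ o<s)) (sym (level-before q o<s)))
      byPosition (tri≈ _ o≡s _) = subst (λ o → f⁺At q o ~ f⁺At q (suc o)) (sym o≡s) (f⁺At-switch q)
      byPosition (tri> _ _ s<o) =
        f⁺At-same-level q o (trans (level-after q s<o) (sym (level-after q (m<n⇒m<1+n s<o))))

    f⁺At-next-row : ∀ q → f⁺At q n ≡ f⁺At (suc q) 0
    f⁺At-next-row q =
      cong₂ 𝔹.snake (trans (level-after q (switch<n q)) (sym (level-before (suc q) z≤n)))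
                    (cong F (αAt-next-row q))

    F⁺ : ℕ → ℕ
    F⁺ = 𝔸.onGrid f⁺At

    F⁺-walk : Walk F⁺
    F⁺-walk = 𝔸.onGrid-walk f⁺At (λ q o _ → f⁺At-in-row q o) (~-reflexive ∘ f⁺At-next-row)

    F⁺-≤ : ∀ p → F⁺ p ≤ B⁺
    F⁺-≤ p = 𝔹.snake-≤ {Q = B′} (level-≤ (𝔸.row p) (𝔸.pos p)) (F-≤ _)

    visitCell : Pt A′ → Pt A → ℕ
    visitCell k t = 𝔸.cell (toℕ k + toℕ k) (visit (toℕ k + toℕ k) (toℕ t))

    visitCell≤A⁺ : ∀ k t → visitCell k t ≤ A⁺
    visitCell≤A⁺ k t =
      𝔸.cell-mono {Q = A′ + A′} (+-mono-≤ k≤A′ k≤A′) (<⇒≤ (visit<n (toℕ k + toℕ k) (toℕ≤pred[n] t)))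
      where k≤A′ = toℕ≤pred[n] k

    F⁺-visitCell : ∀ k t → F⁺ (visitCell k t) ≡ 𝔹.snake (toℕ (proj₁ f′ k)) (toℕ (proj₁ f t))
    F⁺-visitCell k t = begin
      F⁺ (𝔸.cell q o)                    ≡⟨ 𝔸.onGrid-cell f⁺At q (<⇒≤ (visit<n q t≤A)) ⟩
      𝔹.snake (level q o) (F (αAt q o))  ≡⟨ cong₂ 𝔹.snake level≡ (cong F (αAt-visit q t≤A)) ⟩
      𝔹.snake (F′ (toℕ k)) (F (toℕ t))   ≡⟨ cong₂ 𝔹.snake (cong (toℕ ∘ proj₁ f′) (clamp-toℕ k))
                                                          (cong (toℕ ∘ proj₁ f) (clamp-toℕ t)) ⟩
      𝔹.snake (toℕ (proj₁ f′ k)) (toℕ (proj₁ f t)) ∎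
      where
      open ≡-Reasoning
      q = toℕ k + toℕ k
      o = visit q (toℕ t)
      t≤A = toℕ≤pred[n] t
      level≡ : level q o ≡ F′ (toℕ k)
      level≡ = threshold-elim (_≡ F′ (toℕ k))
        (cong F′ (sym (n≡⌊n+n/2⌋ (toℕ k)))) (cong F′ (sym (n≡⌈n+n/2⌉ (toℕ k)))) o

    F⁺-reaches : ∀ {r x} → r ≤ B′ → x ≤ B → ∃[ p ] p ≤ A⁺ × F⁺ p ≡ 𝔹.snake r x
    F⁺-reaches r≤B′ x≤B =
      let k , f′k≡r = epi-hits (proj₂ f′) r≤B′
          t , ft≡x  = epi-hits (proj₂ f) x≤B
      in visitCell k t , visitCell≤A⁺ k t , trans (F⁺-visitCell k t) (cong₂ 𝔹.snake f′k≡r ft≡x)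

    f⁺ : Epi A⁺ B⁺
    f⁺ = clampMap B⁺ F⁺ ,
         walk-epi F⁺-walk {A⁺} {B⁺} (proj₁ (proj₂ first)) (proj₁ (proj₂ last))
                  (proj₂ (proj₂ first)) (trans (proj₂ (proj₂ last)) (𝔹.snake-exit B′))
      where
      first = F⁺-reaches z≤n z≤n
      last  = F⁺-reaches ≤-refl (sweep-≤ (parity B′) ≤-refl)

    square : ∀ a → proj₁ f (proj₁ α a) ≡ proj₁ β (proj₁ f⁺ a)
    square a = sym (begin
      clamp B (𝔹.column (toℕ (clamp B⁺ (F⁺ p))))
        ≡⟨ cong (clamp B ∘ 𝔹.column) (toℕ-clamp-≤ (F⁺-≤ p)) ⟩
      clamp B (𝔹.column (F⁺ p))
        ≡⟨ cong (clamp B) (𝔹.column-snake (level q o) (F-≤ _)) ⟩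
      clamp B (F (αAt q o))
        ≡⟨ clamp-toℕ _ ⟩
      proj₁ f (clamp A (αAt q o))
        ∎)
      where
      open ≡-Reasoning
      p = toℕ a
      q = 𝔸.row p
      o = 𝔸.pos p

    near : ∀ a → proj₁ f′ (proj₁ α′ a) R proj₁ β′ (proj₁ f⁺ a)
    near a = ~⇒R {x = proj₁ f′ (proj₁ α′ a)} {y = proj₁ β′ (proj₁ f⁺ a)}
      (subst (lower q ~_) (sym row≡level) (lower~level q o))
      where
      open ≡-Reasoning
      p = toℕ a
      q = 𝔸.row p
      o = 𝔸.pos p
      row≡level : toℕ (clamp B′ (𝔹.row (toℕ (clamp B⁺ (F⁺ p))))) ≡ level q o
      row≡level = begin
        toℕ (clamp B′ (𝔹.row (toℕ (clamp B⁺ (F⁺ p)))))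
          ≡⟨ cong (toℕ ∘ clamp B′ ∘ 𝔹.row) (toℕ-clamp-≤ (F⁺-≤ p)) ⟩
        toℕ (clamp B′ (𝔹.row (F⁺ p)))
          ≡⟨ cong (toℕ ∘ clamp B′) (𝔹.row-snake (level q o) (F-≤ _)) ⟩
        toℕ (clamp B′ (level q o))
          ≡⟨ toℕ-clamp-≤ (level-≤ q o) ⟩
        level q o
          ∎

lemma4p2 : (A B A′ B′ : ℕ) →
    ∃[ A⁺ ] ∃[ B⁺ ]
    Σ (Epi A⁺ A) λ α → Σ (Epi A⁺ A′) λ α′ →
    Σ (Epi B⁺ B) λ β → Σ (Epi B⁺ B′) λ β′ →
      ((f : Epi A B) → (f′ : Epi A′ B′) →
        Σ (Epi A⁺ B⁺) λ f⁺ →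
          ((a : Pt A⁺) → proj₁ f (proj₁ α a) ≡ proj₁ β (proj₁ f⁺ a))
          × ((a : Pt A⁺) → proj₁ f′ (proj₁ α′ a) R proj₁ β′ (proj₁ f⁺ a)))
lemma4p2 A B A′ B′ = A⁺ , B⁺ , α , α′ , β , β′ , λ f f′ → let open Lift f f′ in f⁺ , square , near
  where open Construction A B A′ B′
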